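{- Let $A$ be a DLCMI whose lattice reduct has a least element $0$, let $\neg x$ denote $x\to 0$, and let $n$ be a natural number. For a function $\gamma:A\to A$ the following are equivalent: (I) for all $a,b\in A$, (g1) $a\vee\neg(\gamma(a))^n\le\gamma(a)$ and (g2) $\gamma(a)\le a\vee\neg b^n\vee b$; (II) for all $a,b\in A$, (g3) $\neg(\gamma(0))^n\le\gamma(0)$, (g4) $\gamma(0)\le b\vee\neg b^n$, and (g5) $\gamma(a)=a\vee\gamma(0)$. In particular, a function $\gamma_n:A\to A$ with $\gamma_n(a)=\min\{b\in A: a\vee\neg b^n\le b\}$ for all $a$ (equivalently, satisfying (g1) and (g2)) is a polynomial function of $A$.
   Context: A DLCMI is an algebra $(A,\wedge,\vee,\cdot,\to,1)$ of type $(2,2,2,2,0)$ such that for all $a,b,c\in A$: (1) $(A,\wedge,\vee)$ is a distributive lattice; (2) $1$ is the largest element; (3) $(A,\cdot,1)$ is a commutative monoid; (4) $(a\to b)\wedge(a\to c)=a\to(b\wedge c)$; (5) $(a\to c)\wedge(b\to c)=(a\vee b)\to c$; (6) $a\to a=1$; (7) $(a\vee b)\cdot c=(a\cdot c)\vee(b\cdot c)$; (8) $(a\to b)\cdot(b\to c)\le a\to c$; (9) $a\to b\le (a\cdot c)\to(b\cdot c)$. Powers: $x^0=1$, $x^n=x\cdot x^{n-1}$. -}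

module Defs where

open import Level using (0ℓ)
open import Data.Nat using (ℕ; zero; suc)
open import Data.Product using (_×_; Σ)
open import Relation.Binary.PropositionalEquality using (_≡_)
import Algebra.Structures as AS
import Algebra.Lattice.Structures as LS

record DLCMI : Set₁ where
  infixr 6 _∨_
  infixr 7 _∧_
  infixr 8 _·_
  infixr 5 _⇒_
  infix 4 _≤_
  field
    Carrier : Set
    _∧_ _∨_ _·_ _⇒_ : Carrier → Carrier → Carrier
    𝟙 : Carrier
    isDistributiveLattice : LS.IsDistributiveLattice {A = Carrier} _≡_ _∨_ _∧_
  _≤_ : Carrier → Carrier → Set
  a ≤ b = a ∧ b ≡ a
  field
    top : ∀ a → a ≤ 𝟙
    isCommutativeMonoid : AS.IsCommutativeMonoid {A = Carrier} _≡_ _·_ 𝟙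
    ⇒-∧ : ∀ a b c → (a ⇒ b) ∧ (a ⇒ c) ≡ a ⇒ (b ∧ c)
    ⇒-∨ : ∀ a b c → (a ⇒ c) ∧ (b ⇒ c) ≡ (a ∨ b) ⇒ c
    ⇒-refl : ∀ a → a ⇒ a ≡ 𝟙
    ·-distrib-∨ : ∀ a b c → (a ∨ b) · c ≡ (a · c) ∨ (b · c)
    ⇒-trans : ∀ a b c → (a ⇒ b) · (b ⇒ c) ≤ (a ⇒ c)
    ⇒-mono-· : ∀ a b c → (a ⇒ b) ≤ ((a · c) ⇒ (b · c))

  _^_ : Carrier → ℕ → Carrier
  x ^ zero = 𝟙
  x ^ suc n = x · (x ^ n)

record BoundedDLCMI : Set₁ where
  field
    dlcmi : DLCMI
  open DLCMI dlcmi public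
  field
    𝟘 : Carrier
    bottom : ∀ a → 𝟘 ≤ a

  ¬_ : Carrier → Carrier
  ¬ x = x ⇒ 𝟘

  data Poly : Set where
    var : Poly
    const : Carrier → Poly
    one : Poly
    _∧ₚ_ _∨ₚ_ _·ₚ_ _⇒ₚ_ : Poly → Poly → Poly

  ⟦_⟧ : Poly → Carrier → Carrier
  ⟦ var ⟧ x = x
  ⟦ const c ⟧ x = c
  ⟦ one ⟧ x = 𝟙
  ⟦ p ∧ₚ q ⟧ x = ⟦ p ⟧ x ∧ ⟦ q ⟧ x
  ⟦ p ∨ₚ q ⟧ x = ⟦ p ⟧ x ∨ ⟦ q ⟧ x
  ⟦ p ·ₚ q ⟧ x = ⟦ p ⟧ x · ⟦ q ⟧ x
  ⟦ p ⇒ₚ q ⟧ x = ⟦ p ⟧ x ⇒ ⟦ q ⟧ x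

  IsPolynomial : (Carrier → Carrier) → Set
  IsPolynomial γ = Σ Poly λ p → ∀ a → γ a ≡ ⟦ p ⟧ a

  CondI : ℕ → (Carrier → Carrier) → Set
  CondI n γ = ∀ a b → (a ∨ (¬ (γ a ^ n)) ≤ γ a) × (γ a ≤ a ∨ (¬ (b ^ n)) ∨ b)

  CondII : ℕ → (Carrier → Carrier) → Set
  CondII n γ = ∀ a b → ((¬ (γ 𝟘 ^ n)) ≤ γ 𝟘) × (γ 𝟘 ≤ b ∨ (¬ (b ^ n))) × (γ a ≡ a ∨ γ 𝟘)

  IsMinGamma : ℕ → (Carrier → Carrier) → Set
  IsMinGamma n γ = ∀ a → (a ∨ (¬ (γ a ^ n)) ≤ γ a) × (∀ b → a ∨ (¬ (b ^ n)) ≤ b → γ a ≤ b)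

module Submission where

open import Defs
open import Level using (0ℓ)
open import Data.Nat using (ℕ; zero; suc)
open import Data.Product using (_×_; _,_; proj₁; proj₂)
open import Function.Bundles using (_⇔_; mk⇔)
open import Relation.Binary.PropositionalEquality using (_≡_; sym; trans; cong; subst; subst₂)
open import Algebra.Lattice.Bundles using (Lattice)
import Algebra.Lattice.Properties.Lattice as LatticeProperties
import Algebra.Lattice.Structures as LS
import Algebra.Structures as AS
import Relation.Binary.Lattice.Bundles as Order

-- Call b closed when ¬ bⁿ ≤ b. Closed elements form an up-set, and b ∨ ¬ bⁿ is
-- always closed since ¬ is antitone. Hence (g1) and (g2) say exactly that γ(a) is
-- the least closed element above a; as γ(0) is closed, that element is a ∨ γ(0).

module DLCMIProperties (A : DLCMI) where
  open DLCMI A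
  open LS.IsDistributiveLattice isDistributiveLattice using (isLattice; ∧-comm)
  open AS.IsCommutativeMonoid isCommutativeMonoid using () renaming (comm to ·-comm)

  private
    lattice : Lattice 0ℓ 0ℓ
    lattice = record { isLattice = isLattice }

    -- the library orders by x ≡ x ∧ y, the symmetric reading of _≤_
    module O = Order.Lattice (LatticeProperties.∨-∧-orderTheoreticLattice lattice)

  variable
    x y z x′ y′ : Carrier

  ≤-refl : x ≤ x
  ≤-refl = sym O.refl

  ≤-trans : x ≤ y → y ≤ z → x ≤ z
  ≤-trans p q = sym (O.trans (sym p) (sym q))

  ≤-antisym : x ≤ y → y ≤ x → x ≡ y
  ≤-antisym p q = O.antisym (sym p) (sym q)

  x≤x∨y : ∀ x y → x ≤ x ∨ y
  x≤x∨y x y = sym (O.x≤x∨y x y)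

  y≤x∨y : ∀ x y → y ≤ x ∨ y
  y≤x∨y x y = sym (O.y≤x∨y x y)

  ∨-least : x ≤ z → y ≤ z → x ∨ y ≤ z
  ∨-least p q = sym (O.∨-least (sym p) (sym q))

  x∨y≤z⇒x≤z : x ∨ y ≤ z → x ≤ z
  x∨y≤z⇒x≤z = ≤-trans (x≤x∨y _ _)

  x∨y≤z⇒y≤z : x ∨ y ≤ z → y ≤ z
  x∨y≤z⇒y≤z = ≤-trans (y≤x∨y _ _)

  ∨-monoʳ-≤ : ∀ x → y ≤ z → x ∨ y ≤ x ∨ z
  ∨-monoʳ-≤ x p = ∨-least (x≤x∨y _ _) (≤-trans p (y≤x∨y _ _))

  ≤⇒∨≡ : x ≤ y → x ∨ y ≡ y
  ≤⇒∨≡ p = ≤-antisym (∨-least p ≤-refl) (y≤x∨y _ _)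

  ∨≡⇒≤ : x ∨ y ≡ y → x ≤ y
  ∨≡⇒≤ {x} p = subst (x ≤_) p (x≤x∨y _ _)

  ·-monoˡ-≤ : ∀ z → x ≤ y → x · z ≤ y · z
  ·-monoˡ-≤ {x} {y} z p = ∨≡⇒≤ (trans (sym (·-distrib-∨ x y z)) (cong (_· z) (≤⇒∨≡ p)))

  ·-mono-≤ : x ≤ x′ → y ≤ y′ → x · y ≤ x′ · y′
  ·-mono-≤ p q = ≤-trans (·-monoˡ-≤ _ p)
    (subst₂ _≤_ (·-comm _ _) (·-comm _ _) (·-monoˡ-≤ _ q))

  ^-monoˡ-≤ : ∀ m → x ≤ y → x ^ m ≤ y ^ m
  ^-monoˡ-≤ zero    p = ≤-refl
  ^-monoˡ-≤ (suc m) p = ·-mono-≤ p (^-monoˡ-≤ m p)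

  ⇒-antitoneˡ-≤ : ∀ z → x ≤ y → y ⇒ z ≤ x ⇒ z
  ⇒-antitoneˡ-≤ {x} {y} z p =
    trans (∧-comm _ _) (trans (⇒-∨ x y z) (cong (_⇒ z) (≤⇒∨≡ p)))

module Closure (A : BoundedDLCMI) (n : ℕ) where
  open BoundedDLCMI A
  open DLCMIProperties dlcmi
  open LS.IsDistributiveLattice isDistributiveLattice using (∨-comm)

  Closed : Carrier → Set
  Closed b = ¬ (b ^ n) ≤ b

  variable
    a b c : Carrier
    γ : Carrier → Carrier

  ¬^-antitone : a ≤ b → ¬ (b ^ n) ≤ ¬ (a ^ n)
  ¬^-antitone p = ⇒-antitoneˡ-≤ 𝟘 (^-monoˡ-≤ n p)

  closed-above-¬^ : b ≤ c → ¬ (b ^ n) ≤ c → Closed c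
  closed-above-¬^ p q = ≤-trans (¬^-antitone p) q

  Closed-upward : Closed b → b ≤ c → Closed c
  Closed-upward cl p = closed-above-¬^ p (≤-trans cl p)

  ∨-¬^-closed : ∀ b → Closed (b ∨ ¬ (b ^ n))
  ∨-¬^-closed b = closed-above-¬^ (x≤x∨y _ _) (y≤x∨y _ _)

  ∨-¬^-∨-closed : ∀ a b → Closed (a ∨ ¬ (b ^ n) ∨ b)
  ∨-¬^-∨-closed a b = closed-above-¬^
    (≤-trans (y≤x∨y _ _) (y≤x∨y a _)) (≤-trans (x≤x∨y _ b) (y≤x∨y a _))

  module _ (h : CondI n γ) where
    CondI-extensive : ∀ a → a ≤ γ a
    CondI-extensive a = x∨y≤z⇒x≤z (proj₁ (h a a))

    CondI-closed : ∀ a → Closed (γ a)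
    CondI-closed a = x∨y≤z⇒y≤z (proj₁ (h a a))

    CondI-least : a ≤ c → Closed c → γ a ≤ c
    CondI-least {a} {c} p cl = ≤-trans (proj₂ (h a c)) (∨-least p (∨-least cl ≤-refl))

  IsMinGamma⇒CondI : IsMinGamma n γ → CondI n γ
  IsMinGamma⇒CondI m a b =
    proj₁ (m a) , proj₂ (m a) _ (∨-least (x≤x∨y _ _) (∨-¬^-∨-closed a b))

  CondI⇒CondII : CondI n γ → CondII n γ
  CondI⇒CondII {γ} h a b = closed 𝟘 , least (bottom _) (∨-¬^-closed b) , γa≡a∨γ𝟘
    where
    closed = CondI-closed h
    least  = CondI-least h

    γa≡a∨γ𝟘 : γ a ≡ a ∨ γ 𝟘
    γa≡a∨γ𝟘 = ≤-antisym
      (least (x≤x∨y _ _) (Closed-upward (closed 𝟘) (y≤x∨y _ _)))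
      (∨-least (CondI-extensive h a) (least (bottom _) (closed a)))

  CondII⇒CondI : CondII n γ → CondI n γ
  CondII⇒CondI {γ} k a b = subst (λ g → (a ∨ ¬ (g ^ n) ≤ g) × (g ≤ a ∨ ¬ (b ^ n) ∨ b))
    (sym γa≡a∨γ𝟘)
    ( ∨-least (x≤x∨y _ _) (Closed-upward γ𝟘-closed (y≤x∨y _ _))
    , ∨-monoʳ-≤ a (subst (γ 𝟘 ≤_) (∨-comm b _) γ𝟘≤b∨¬bⁿ) )
    where
    γ𝟘-closed = proj₁ (k a b)
    γ𝟘≤b∨¬bⁿ  = proj₁ (proj₂ (k a b))
    γa≡a∨γ𝟘   = proj₂ (proj₂ (k a b))

  IsMinGamma⇒IsPolynomial : IsMinGamma n γ → IsPolynomial γ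
  IsMinGamma⇒IsPolynomial m =
    var ∨ₚ const _ , λ a → proj₂ (proj₂ (CondI⇒CondII (IsMinGamma⇒CondI m) a a))

lemma4p11 : (A : BoundedDLCMI) (n : ℕ) → let open BoundedDLCMI A in
    (∀ (γ : Carrier → Carrier) → CondI n γ ⇔ CondII n γ)
    × (∀ (γ : Carrier → Carrier) → IsMinGamma n γ → IsPolynomial γ)
lemma4p11 A n =
  (λ γ → mk⇔ CondI⇒CondII CondII⇒CondI) , λ γ → IsMinGamma⇒IsPolynomial
  where open Closure A n
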